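{- Let $W$ be a non-empty set and let $\mathfrak{A}$ be a family of binary relations on $W$ closed under $\backslash$, $/$ and $\cap$ (not necessarily under $\circ$). Suppose $\mathbf{0}_{\mathfrak{A}}\in\mathfrak{A}$ satisfies $\mathbf{0}_{\mathfrak{A}}\subseteq R$ for every $R\in\mathfrak{A}$. Then $R_1\circ\cdots\circ R_m\circ\mathbf{0}_{\mathfrak{A}}\circ S_1\circ\cdots\circ S_k\subseteq\mathbf{0}_{\mathfrak{A}}$ for all $m,k\ge0$ and all $R_1,\ldots,R_m,S_1,\ldots,S_k\in\mathfrak{A}$.
   Context: For binary relations $R,S$ on $W$: $R\circ S=\{(x,z) \mid \exists y\in W\,((x,y)\in R \text{ and } (y,z)\in S)\}$; $R\backslash S=\{(y,z)\in W\times W \mid \forall x\in W\,((x,y)\in R\Rightarrow (x,z)\in S)\}$; $S/R=\{(x,y)\in W\times W \mid \forall z\in W\,((y,z)\in R\Rightarrow(x,z)\in S)\}$. -}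

module Defs where

open import Level using (Level; _⊔_; suc)
open import Data.Product using (Σ; ∃; _×_; _,_)
open import Data.List using (List; []; _∷_; foldr)
open import Relation.Binary.Core using (Rel)

_⨾_ : ∀ {ℓ} {W : Set ℓ} → Rel W ℓ → Rel W ℓ → Rel W ℓ
(R ⨾ S) x z = Σ _ λ y → R x y × S y z

_⧵_ : ∀ {ℓ} {W : Set ℓ} → Rel W ℓ → Rel W ℓ → Rel W ℓ
(R ⧵ S) y z = ∀ x → R x y → S x z

_⧸_ : ∀ {ℓ} {W : Set ℓ} → Rel W ℓ → Rel W ℓ → Rel W ℓ
(S ⧸ R) x y = ∀ z → R y z → S x z

_∩_ : ∀ {ℓ} {W : Set ℓ} → Rel W ℓ → Rel W ℓ → Rel W ℓ
(R ∩ S) x y = R x y × S x y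

_⊆ᵣ_ : ∀ {ℓ} {W : Set ℓ} → Rel W ℓ → Rel W ℓ → Set ℓ
R ⊆ᵣ S = ∀ x y → R x y → S x y

compL : ∀ {ℓ} {W : Set ℓ} → List (Rel W ℓ) → Rel W ℓ → Rel W ℓ
compL Rs T = foldr _⨾_ T Rs

compR : ∀ {ℓ} {W : Set ℓ} → Rel W ℓ → List (Rel W ℓ) → Rel W ℓ
compR T [] = T
compR T (S ∷ Ss) = compR (T ⨾ S) Ss

{-# OPTIONS --safe #-}
module Submission where

-- The residual R ⧵ O is the largest relation X with R ⨾ X ⊆ O, and O ⧸ S is the
-- largest X with X ⨾ S ⊆ O. When both residuals lie in 𝔄, the least element O is
-- contained in them, so R ⨾ O ⊆ O and O ⨾ S ⊆ O; the corollary follows by absorbing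
-- the factors one at a time, first from the left, then from the right.

open import Defs
open import Level using (suc)
open import Data.List using (List; []; _∷_)
open import Data.List.Relation.Unary.All using (All; []; _∷_)
open import Data.Product using (_,_)
open import Relation.Binary.Core using (Rel)

module _ {ℓ} {W : Set ℓ} where

  ⨾-absorbˡ : (R O : Rel W ℓ) → O ⊆ᵣ (R ⧵ O) → (R ⨾ O) ⊆ᵣ O
  ⨾-absorbˡ R O O⊆R⧵O x z (y , Rxy , Oyz) = O⊆R⧵O y z Oyz x Rxy

  ⨾-absorbʳ : (O S : Rel W ℓ) → O ⊆ᵣ (O ⧸ S) → (O ⨾ S) ⊆ᵣ O
  ⨾-absorbʳ O S O⊆O⧸S x z (y , Oxy , Syz) = O⊆O⧸S x y Oxy z Syz

  ⨾-monoʳ : (R : Rel W ℓ) {T U : Rel W ℓ} → T ⊆ᵣ U → (R ⨾ T) ⊆ᵣ (R ⨾ U)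
  ⨾-monoʳ R T⊆U x z (y , Rxy , Tyz) = y , Rxy , T⊆U y z Tyz

  ⨾-monoˡ : (S : Rel W ℓ) {T U : Rel W ℓ} → T ⊆ᵣ U → (T ⨾ S) ⊆ᵣ (U ⨾ S)
  ⨾-monoˡ S T⊆U x z (y , Txy , Syz) = y , T⊆U x y Txy , Syz

  ⊆ᵣ-trans : {T U V : Rel W ℓ} → T ⊆ᵣ U → U ⊆ᵣ V → T ⊆ᵣ V
  ⊆ᵣ-trans T⊆U U⊆V x y Txy = U⊆V x y (T⊆U x y Txy)

  compL-absorb : {O : Rel W ℓ} (P : Rel W ℓ → Set (suc ℓ)) →
                 (∀ R → P R → O ⊆ᵣ (R ⧵ O)) →
                 (Rs : List (Rel W ℓ)) → All P Rs → compL Rs O ⊆ᵣ O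
  compL-absorb P absorbs []       []         x y Oxy = Oxy
  compL-absorb P absorbs (R ∷ Rs) (PR ∷ PRs) =
    ⊆ᵣ-trans (⨾-monoʳ R (compL-absorb P absorbs Rs PRs)) (⨾-absorbˡ R _ (absorbs R PR))

  compR-absorb : {O T : Rel W ℓ} (P : Rel W ℓ → Set (suc ℓ)) →
                 (∀ S → P S → O ⊆ᵣ (O ⧸ S)) → T ⊆ᵣ O →
                 (Ss : List (Rel W ℓ)) → All P Ss → compR T Ss ⊆ᵣ O
  compR-absorb P absorbs T⊆O []       []         = T⊆O
  compR-absorb P absorbs T⊆O (S ∷ Ss) (PS ∷ PSs) =
    compR-absorb P absorbs (⊆ᵣ-trans (⨾-monoˡ S T⊆O) (⨾-absorbʳ _ S (absorbs S PS))) Ss PSs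

corollary7p2 : ∀ {ℓ} (W : Set ℓ) → W
    → (𝔄 : Rel W ℓ → Set (suc ℓ))
    → (∀ R S → 𝔄 R → 𝔄 S → 𝔄 (R ⧵ S))
    → (∀ R S → 𝔄 R → 𝔄 S → 𝔄 (S ⧸ R))
    → (∀ R S → 𝔄 R → 𝔄 S → 𝔄 (R ∩ S))
    → (O : Rel W ℓ) → 𝔄 O → (∀ R → 𝔄 R → O ⊆ᵣ R)
    → (Rs Ss : List (Rel W ℓ)) → All 𝔄 Rs → All 𝔄 Ss
    → compR (compL Rs O) Ss ⊆ᵣ O
corollary7p2 W _ 𝔄 ⧵-closed ⧸-closed _ O 𝔄O O-least Rs Ss 𝔄Rs 𝔄Ss =
  compR-absorb 𝔄 O⊆O⧸ (compL-absorb 𝔄 O⊆⧵O Rs 𝔄Rs) Ss 𝔄Ss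
  where
  O⊆⧵O : ∀ R → 𝔄 R → O ⊆ᵣ (R ⧵ O)
  O⊆⧵O R 𝔄R = O-least (R ⧵ O) (⧵-closed R O 𝔄R 𝔄O)

  O⊆O⧸ : ∀ S → 𝔄 S → O ⊆ᵣ (O ⧸ S)
  O⊆O⧸ S 𝔄S = O-least (O ⧸ S) (⧸-closed S O 𝔄S 𝔄O)
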